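{- Let $H$ be a Heyting algebra and $a\in H$. Then there exist a set $D$, a subalgebra $H[\iota]\subseteq H^D$ containing the diagonal copy of $H$ in $H^D$, a Heyting algebra $H\langle\Delta(a)\rangle$ and a surjective homomorphism $\pi:H[\iota]\to H\langle\Delta(a)\rangle$ such that, writing $\pi(h)$ for the image under $\pi$ of the diagonal (constant) element corresponding to $h\in H$: (a) the filter $\mathcal D_{\pi(a)}(H\langle\Delta(a)\rangle)$ is principal; (b) the composite homomorphism $H\hookrightarrow H[\iota]\to H\langle\Delta(a)\rangle$ (diagonal embedding followed by $\pi$) is one-to-one; (c) for every $b\in H$ such that the filter $\mathcal D_b(H)$ is principal, the filter $\mathcal D_{\pi(b)}(H\langle\Delta(a)\rangle)$ is principal as well.
   Context: For an element $a$ of a Heyting algebra $A$, $\mathcal D_a(A)=\{d\in A: a\le d \text{ and } (d\to a)=a\}$ is the set of elements dense over $a$; it is a filter of $A$. A filter is principal if it has a smallest element. $H^D$ denotes the direct power (product of $D$ copies of $H$, with pointwise operations), and the diagonal copy of $H$ consists of the constant families. -}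

module Defs where

open import Level using (Level; _⊔_; suc)
open import Data.Product using (Σ; ∃; _×_; _,_; proj₁)
open import Relation.Binary.Lattice.Bundles using (HeytingAlgebra)

module _ {c ℓ₁ ℓ₂} (A : HeytingAlgebra c ℓ₁ ℓ₂) where
  open HeytingAlgebra A

  DenseOver : Carrier → Carrier → Set (ℓ₁ ⊔ ℓ₂)
  DenseOver a d = (a ≤ d) × ((d ⇨ a) ≈ a)

  DensePrincipal : Carrier → Set (c ⊔ ℓ₁ ⊔ ℓ₂)
  DensePrincipal a =
    Σ Carrier λ m → DenseOver a m × (∀ d → DenseOver a d → m ≤ d)

module _ {c ℓ₁ ℓ₂} (H : HeytingAlgebra c ℓ₁ ℓ₂) where
  open HeytingAlgebra H

  _≈ᴰ_ : ∀ {d} {D : Set d} → (D → Carrier) → (D → Carrier) → Set (d ⊔ ℓ₁)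
  f ≈ᴰ g = ∀ i → f i ≈ g i

  const : ∀ {d} {D : Set d} → Carrier → D → Carrier
  const h _ = h

  record Subalgebra {d} (D : Set d) (p : Level) : Set (c ⊔ ℓ₁ ⊔ d ⊔ suc p) where
    field
      member  : (D → Carrier) → Set p
      resp    : ∀ {f g} → f ≈ᴰ g → member f → member g
      ∧-closed : ∀ {f g} → member f → member g → member (λ i → f i ∧ g i)
      ∨-closed : ∀ {f g} → member f → member g → member (λ i → f i ∨ g i)
      ⇨-closed : ∀ {f g} → member f → member g → member (λ i → f i ⇨ g i)
      ⊤-closed : member (λ _ → ⊤)
      ⊥-closed : member (λ _ → ⊥)

    Elem : Set (c ⊔ d ⊔ p)
    Elem = Σ (D → Carrier) member

  record SurjHom {d p c' ℓ₁' ℓ₂'} {D : Set d} (S : Subalgebra D p)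
                 (K : HeytingAlgebra c' ℓ₁' ℓ₂')
                 : Set (c ⊔ ℓ₁ ⊔ d ⊔ p ⊔ c' ⊔ ℓ₁') where
    open Subalgebra S
    module K = HeytingAlgebra K
    field
      map      : Elem → K.Carrier
      cong     : ∀ {x y : Elem} → proj₁ x ≈ᴰ proj₁ y → map x K.≈ map y
      ∧-hom    : ∀ {f g} (mf : member f) (mg : member g) →
                 map ((λ i → f i ∧ g i) , ∧-closed mf mg) K.≈ (map (f , mf) K.∧ map (g , mg))
      ∨-hom    : ∀ {f g} (mf : member f) (mg : member g) →
                 map ((λ i → f i ∨ g i) , ∨-closed mf mg) K.≈ (map (f , mf) K.∨ map (g , mg))
      ⇨-hom    : ∀ {f g} (mf : member f) (mg : member g) →
                 map ((λ i → f i ⇨ g i) , ⇨-closed mf mg) K.≈ (map (f , mf) K.⇨ map (g , mg))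
      ⊤-hom    : map ((λ _ → ⊤) , ⊤-closed) K.≈ K.⊤
      ⊥-hom    : map ((λ _ → ⊥) , ⊥-closed) K.≈ K.⊥
      surjective : ∀ y → Σ Elem λ x → map x K.≈ y

-- Let D be the set of elements dense over a, keep the families f : D → H
-- compatible with the inclusion ι d = d, i.e. f d ∧ (d ⇔ e) ≤ f e, and identify
-- families that agree on some principal downset of D.  If f is dense over the
-- constant a on the downset of j, then f ⊤ ≥ f j ∧ j is dense over a, and on
-- the downset of f ⊤ we have ι ≤ f ⊤ ∧ (⊤ ⇔ ι) ≤ f; so ι is the least element
-- dense over a.  Distinct constants never agree on a downset, and a least
-- element dense over b in H stays least pointwise.
module Submission where

open import Defs
open import Level using (Level; _⊔_; suc; Lift; lift)
open import Data.Product using (Σ; _×_; _,_; proj₁; proj₂)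
open import Relation.Binary.Lattice.Bundles using (HeytingAlgebra)
open import Relation.Binary.Lattice.Structures using (IsHeytingAlgebra)
import Relation.Binary.Lattice.Properties.HeytingAlgebra as HeytingProperties
import Relation.Binary.Lattice.Properties.MeetSemilattice as MeetProperties

module DenseFilter {c ℓ₁ ℓ₂} (H : HeytingAlgebra c ℓ₁ ℓ₂) where
  open HeytingAlgebra H
  open HeytingProperties H using (⇨-eval; y≤x⇨y; ⇨-curry; ⇨-cong; ⇨ˡ-contravariant)

  denseOver-⊤ : ∀ a → DenseOver H a ⊤
  denseOver-⊤ a = maximum a , antisym (trans (∧-greatest refl (maximum _)) ⇨-eval) y≤x⇨y

  denseOver-∧ : ∀ {a x y} → DenseOver H a x → DenseOver H a y → DenseOver H a (x ∧ y)
  denseOver-∧ (a≤x , x⇨a≈a) (a≤y , y⇨a≈a) =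
    ∧-greatest a≤x a≤y , Eq.trans ⇨-curry (Eq.trans (⇨-cong Eq.refl y⇨a≈a) x⇨a≈a)

  denseOver-mono : ∀ {a x y} → DenseOver H a x → x ≤ y → DenseOver H a y
  denseOver-mono (a≤x , x⇨a≈a) x≤y =
    trans a≤x x≤y , antisym (trans (⇨ˡ-contravariant x≤y) (reflexive x⇨a≈a)) y≤x⇨y

module Biimplication {c ℓ₁ ℓ₂} (H : HeytingAlgebra c ℓ₁ ℓ₂) where
  open HeytingAlgebra H
  open HeytingProperties H using (⇨-eval; y≤x⇨y)

  infix 5 _⇔_
  _⇔_ : Carrier → Carrier → Carrier
  x ⇔ y = (x ⇨ y) ∧ (y ⇨ x)

  ⇔-sym : ∀ x y → (x ⇔ y) ≤ (y ⇔ x)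
  ⇔-sym x y = ∧-greatest (x∧y≤y _ _) (x∧y≤x _ _)

  ⇔-eval : ∀ x y → x ∧ (x ⇔ y) ≤ y
  ⇔-eval x y = trans (∧-greatest (trans (x∧y≤y _ _) (x∧y≤x _ _)) (x∧y≤x _ _)) ⇨-eval

  x≤⊤⇔x : ∀ x → x ≤ (⊤ ⇔ x)
  x≤⊤⇔x x = ∧-greatest y≤x⇨y (transpose-⇨ (maximum _))

  x≤x⇔⊤ : ∀ x → x ≤ (x ⇔ ⊤)
  x≤x⇔⊤ x = trans (x≤⊤⇔x x) (⇔-sym ⊤ x)

module CompatibleFamilies {c ℓ₁ ℓ₂} (H : HeytingAlgebra c ℓ₁ ℓ₂)
                          {d} {D : Set d} (ι : D → HeytingAlgebra.Carrier H) where
  open HeytingAlgebra H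
  open HeytingProperties H using (⇨-eval)
  open MeetProperties meetSemilattice using (∧-monotonic)
  open Biimplication H

  Compatible : (D → Carrier) → Set (d ⊔ ℓ₂)
  Compatible f = ∀ i j → f i ∧ (ι i ⇔ ι j) ≤ f j

  compatible-sym : ∀ {f} → Compatible f → ∀ i j → f j ∧ (ι i ⇔ ι j) ≤ f i
  compatible-sym cf i j = trans (∧-monotonic refl (⇔-sym (ι i) (ι j))) (cf j i)

  ⇨-compatible : ∀ {f g} → Compatible f → Compatible g →
                 Compatible (λ i → f i ⇨ g i)
  ⇨-compatible {f} {g} cf cg i j = transpose-⇨ (begin
    ((f i ⇨ g i) ∧ r) ∧ f j   ≤⟨ ∧-greatest (∧-greatest (trans (x∧y≤x _ _) (x∧y≤x _ _)) fi-bound)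
                                            (trans (x∧y≤x _ _) (x∧y≤y _ _)) ⟩
    ((f i ⇨ g i) ∧ f i) ∧ r   ≤⟨ ∧-monotonic ⇨-eval refl ⟩
    g i ∧ r                   ≤⟨ cg i j ⟩
    g j                       ∎)
    where
    open import Relation.Binary.Reasoning.PartialOrder poset
    r = ι i ⇔ ι j
    fi-bound : ((f i ⇨ g i) ∧ r) ∧ f j ≤ f i
    fi-bound = trans (∧-greatest (x∧y≤y _ _) (trans (x∧y≤x _ _) (x∧y≤y _ _))) (compatible-sym cf i j)

  compatibles : Subalgebra H D (d ⊔ ℓ₂)
  compatibles = record
    { member   = Compatible
    ; resp     = λ f≈g cf i j →
        trans (∧-monotonic (reflexive (Eq.sym (f≈g i))) refl) (trans (cf i j) (reflexive (f≈g j)))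
    ; ∧-closed = λ cf cg i j → ∧-greatest
        (trans (∧-monotonic (x∧y≤x _ _) refl) (cf i j))
        (trans (∧-monotonic (x∧y≤y _ _) refl) (cg i j))
    ; ∨-closed = λ cf cg i j → transpose-∧ (∨-least
        (transpose-⇨ (trans (cf i j) (x≤x∨y _ _)))
        (transpose-⇨ (trans (cg i j) (y≤x∨y _ _))))
    ; ⇨-closed = ⇨-compatible
    ; ⊤-closed = λ i j → x∧y≤x _ _
    ; ⊥-closed = λ i j → x∧y≤x _ _
    }

  const-compatible : ∀ h → Compatible (const H h)
  const-compatible h i j = x∧y≤x _ _

  ι-compatible : Compatible ι
  ι-compatible i j = ⇔-eval (ι i) (ι j)

-- Eventually P: P holds on some downset {i | i ⊑ j}.
record DownDirected {d} (D : Set d) (r : Level) : Set (d ⊔ suc r) where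
  infix 4 _⊑_
  field
    _⊑_     : D → D → Set r
    ⊑-refl  : ∀ {i} → i ⊑ i
    top     : D
    ⊑-top   : ∀ i → i ⊑ top
    meet    : D → D → D
    meet-⊑ˡ : ∀ {i j k} → i ⊑ meet j k → i ⊑ j
    meet-⊑ʳ : ∀ {i j k} → i ⊑ meet j k → i ⊑ k

  Eventually : ∀ {q} → (D → Set q) → Set (d ⊔ r ⊔ q)
  Eventually P = Σ D λ j → ∀ i → i ⊑ j → P i

  always : ∀ {q} {P : D → Set q} → (∀ i → P i) → Eventually P
  always p = top , λ i _ → p i

  eventually-map : ∀ {q q'} {P : D → Set q} {Q : D → Set q'} →
                   (∀ {i} → P i → Q i) → Eventually P → Eventually Q
  eventually-map f (j , p) = j , λ i i⊑j → f (p i i⊑j)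

  eventually-zipWith : ∀ {q q' q''} {P : D → Set q} {Q : D → Set q'} {R : D → Set q''} →
                       (∀ {i} → P i → Q i → R i) → Eventually P → Eventually Q → Eventually R
  eventually-zipWith f (j , p) (k , q) =
    meet j k , λ i i⊑jk → f (p i (meet-⊑ˡ i⊑jk)) (q i (meet-⊑ʳ i⊑jk))

module ReducedPower {c ℓ₁ ℓ₂} (H : HeytingAlgebra c ℓ₁ ℓ₂)
                    {d p r} {D : Set d} (S : Subalgebra H D p) (B : DownDirected D r) where
  open HeytingAlgebra H
  open Subalgebra S
  open DownDirected B

  infix 4 _≈ₑ_ _≤ₑ_
  _≈ₑ_ : Elem → Elem → Set (d ⊔ r ⊔ ℓ₁)
  (f , _) ≈ₑ (g , _) = Eventually λ i → f i ≈ g i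

  _≤ₑ_ : Elem → Elem → Set (d ⊔ r ⊔ ℓ₂)
  (f , _) ≤ₑ (g , _) = Eventually λ i → f i ≤ g i

  _∧ₑ_ _∨ₑ_ _⇨ₑ_ : Elem → Elem → Elem
  (f , mf) ∧ₑ (g , mg) = (λ i → f i ∧ g i) , ∧-closed mf mg
  (f , mf) ∨ₑ (g , mg) = (λ i → f i ∨ g i) , ∨-closed mf mg
  (f , mf) ⇨ₑ (g , mg) = (λ i → f i ⇨ g i) , ⇨-closed mf mg

  ⊤ₑ ⊥ₑ : Elem
  ⊤ₑ = (λ _ → ⊤) , ⊤-closed
  ⊥ₑ = (λ _ → ⊥) , ⊥-closed

  isHeytingAlgebraₑ : IsHeytingAlgebra _≈ₑ_ _≤ₑ_ _∨ₑ_ _∧ₑ_ _⇨ₑ_ ⊤ₑ ⊥ₑ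
  isHeytingAlgebraₑ = record
    { isBoundedLattice = record
      { isLattice = record
        { isPartialOrder = record
          { isPreorder = record
            { isEquivalence = record
              { refl  = always λ _ → Eq.refl
              ; sym   = eventually-map Eq.sym
              ; trans = eventually-zipWith Eq.trans
              }
            ; reflexive = eventually-map reflexive
            ; trans     = eventually-zipWith trans
            }
          ; antisym = eventually-zipWith antisym
          }
        ; supremum = λ _ _ → always (λ _ → x≤x∨y _ _) , always (λ _ → y≤x∨y _ _) ,
                             λ _ → eventually-zipWith ∨-least
        ; infimum  = λ _ _ → always (λ _ → x∧y≤x _ _) , always (λ _ → x∧y≤y _ _) ,
                             λ _ → eventually-zipWith ∧-greatest
        }
      ; maximum = λ _ → always λ _ → maximum _
      ; minimum = λ _ → always λ _ → minimum _
      }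
    ; exponential = λ _ _ _ → eventually-map transpose-⇨ , eventually-map transpose-∧
    }

  reducedPower : HeytingAlgebra (c ⊔ d ⊔ p) (d ⊔ r ⊔ ℓ₁) (d ⊔ r ⊔ ℓ₂)
  reducedPower = record { isHeytingAlgebra = isHeytingAlgebraₑ }

  quotient : SurjHom H S reducedPower
  quotient = record
    { map        = λ f → f
    ; cong       = always
    ; ∧-hom      = λ _ _ → always λ _ → Eq.refl
    ; ∨-hom      = λ _ _ → always λ _ → Eq.refl
    ; ⇨-hom      = λ _ _ → always λ _ → Eq.refl
    ; ⊤-hom      = always λ _ → Eq.refl
    ; ⊥-hom      = always λ _ → Eq.refl
    ; surjective = λ f → f , always λ _ → Eq.refl
    }

  const-injective : ∀ {h h'} (mh : member (const H h)) (mh' : member (const H h')) →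
                    (const H h , mh) ≈ₑ (const H h' , mh') → h ≈ h'
  const-injective _ _ (j , h≈h') = h≈h' j ⊑-refl

  const-densePrincipal : (diag : ∀ h → member (const H h)) →
                         ∀ b → DensePrincipal H b → DensePrincipal reducedPower (const H b , diag b)
  const-densePrincipal diag b (m , m-dense , m-least) =
    (const H m , diag m) , (always (λ _ → proj₁ m-dense) , always (λ _ → proj₂ m-dense)) ,
    λ _ (b≤f , f⇨b≈b) → eventually-zipWith (λ p q → m-least _ (p , q)) b≤f f⇨b≈b

module GenericDense {c ℓ₁ ℓ₂} (H : HeytingAlgebra c ℓ₁ ℓ₂) (a : HeytingAlgebra.Carrier H) where
  open HeytingAlgebra H
  open DenseFilter H
  open Biimplication H
  open MeetProperties meetSemilattice using (∧-monotonic)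

  L : Level
  L = suc (c ⊔ ℓ₁ ⊔ ℓ₂)

  -- Lifted so that the index set lives in the universe the theorem asks for.
  D : Set L
  D = Lift L (Σ Carrier (DenseOver H a))

  ι : D → Carrier
  ι (lift (x , _)) = x

  ι-dense : ∀ i → DenseOver H a (ι i)
  ι-dense (lift (_ , x-dense)) = x-dense

  below : DownDirected D ℓ₂
  below = record
    { _⊑_     = λ i j → ι i ≤ ι j
    ; ⊑-refl  = refl
    ; top     = lift (⊤ , denseOver-⊤ a)
    ; ⊑-top   = λ _ → maximum _
    ; meet    = λ j k → lift (ι j ∧ ι k , denseOver-∧ (ι-dense j) (ι-dense k))
    ; meet-⊑ˡ = λ i≤j∧k → trans i≤j∧k (x∧y≤x _ _)
    ; meet-⊑ʳ = λ i≤j∧k → trans i≤j∧k (x∧y≤y _ _)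
    }

  open DownDirected below using (top; always; eventually-zipWith)
  open CompatibleFamilies H ι public
  open ReducedPower H compatibles below public

  generic : Subalgebra.Elem compatibles
  generic = ι , ι-compatible

  compatible-to-top : ∀ {f} → Compatible f → ∀ i → f i ∧ ι i ≤ f top
  compatible-to-top cf i = trans (∧-monotonic refl (x≤x⇔⊤ (ι i))) (cf i top)

  compatible-from-top : ∀ {f} → Compatible f → ∀ i → f top ∧ ι i ≤ f i
  compatible-from-top cf i = trans (∧-monotonic refl (x≤⊤⇔x (ι i))) (cf top i)

  generic-densePrincipal : DensePrincipal reducedPower (const H a , const-compatible a)
  generic-densePrincipal =
    generic , (always (λ i → proj₁ (ι-dense i)) , always (λ i → proj₂ (ι-dense i))) , least
    where
    least : ∀ f → DenseOver reducedPower (const H a , const-compatible a) f → generic ≤ₑ f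
    least (f , cf) (a≤f , f⇨a≈a) with eventually-zipWith _,_ a≤f f⇨a≈a
    ... | j , f-dense =
      lift (f top , denseOver-mono (denseOver-∧ (f-dense j refl) (ι-dense j)) (compatible-to-top cf j)) ,
      λ i i≤ftop → trans (∧-greatest i≤ftop refl) (compatible-from-top cf i)

theorem3p1 : ∀ {c ℓ₁ ℓ₂} (H : HeytingAlgebra c ℓ₁ ℓ₂) (a : HeytingAlgebra.Carrier H) →
    let L = suc (c ⊔ ℓ₁ ⊔ ℓ₂) in
    Σ (Set L) λ D →
    Σ (Subalgebra H D L) λ S →
    Σ (∀ h → Subalgebra.member S (const H {D = D} h)) λ diag →
    Σ (HeytingAlgebra L L L) λ K →
    Σ (SurjHom H S K) λ π →
    let πc = λ h → SurjHom.map π (const H h , diag h) in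
    DensePrincipal K (πc a)
    × (∀ h h' → HeytingAlgebra._≈_ K (πc h) (πc h') → HeytingAlgebra._≈_ H h h')
    × (∀ b → DensePrincipal H b → DensePrincipal K (πc b))
theorem3p1 H a =
  D , compatibles , const-compatible , reducedPower , quotient ,
  generic-densePrincipal ,
  (λ h h' → const-injective (const-compatible h) (const-compatible h')) ,
  const-densePrincipal const-compatible
  where open GenericDense H a
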